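{- (1) If $\chi_I\vdash c:\chi_O$ and $\chi_I'\supseteq\chi_I$, then there is a $\chi_O'\supseteq\chi_O$ such that $\chi_I'\vdash c:\chi_O'$. (2) If $\chi\vdash\varphi$ and $\chi'\supseteq\chi$, then $\chi'\vdash\varphi$.
   Context: Restrictions: $c ::= p_O(t_1,\ldots,t_n)\mid\vec x\not\in S\mid\top\mid\bot\mid c_1\wedge c_2\mid c_1\vee c_2\mid\exists x.c$, where $p_O$ ranges over objective predicates, each with input argument positions $I(p_O)$ and output positions $O(p_O)$, and $\vec x\not\in S$ is a special atom ($S$ a finite set of tuples of ground terms) all of whose positions are input. Formulas: $\varphi ::= p(t_1,\ldots,t_n)\mid\top\mid\bot\mid\varphi_1\wedge\varphi_2\mid\varphi_1\vee\varphi_2\mid\forall\vec x.(c\supset\varphi)\mid\exists\vec x.(c\wedge\varphi)$, where $p$ is any (objective or subjective) predicate. Mode judgment for restrictions $\chi_I\vdash c:\chi_O$: $\chi_I\vdash p_O(t_1,\ldots,t_n):\chi_I\cup\bigcup_{j\in O(p_O)}\mathrm{fv}(t_j)$ provided $\mathrm{fv}(t_k)\subseteq\chi_I$ for all $k\in I(p_O)$; $\chi_I\vdash\top:\chi_I$; $\chi_I\vdash\bot:\chi_I$; if $\chi_I\vdash c_1:\chi$ and $\chi\vdash c_2:\chi_O$ then $\chi_I\vdash c_1\wedge c_2:\chi_O$; if $\chi_I\vdash c_1:\chi_1$ and $\chi_I\vdash c_2:\chi_2$ then $\chi_I\vdash c_1\vee c_2:\chi_1\cap\chi_2$; if $\chi_I\vdash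 c:\chi_O$ then $\chi_I\vdash\exists x.c:\chi_O\backslash\{x\}$. Mode judgment for formulas $\chi\vdash\varphi$: $\chi\vdash p(t_1,\ldots,t_n)$ if $\mathrm{fv}(t_k)\subseteq\chi$ for all $k$; $\chi\vdash\top$; $\chi\vdash\bot$; $\chi\vdash\varphi_1\wedge\varphi_2$ and $\chi\vdash\varphi_1\vee\varphi_2$ if $\chi\vdash\varphi_1$ and $\chi\vdash\varphi_2$; $\chi\vdash\forall\vec x.(c\supset\varphi)$ and $\chi\vdash\exists\vec x.(c\wedge\varphi)$ if there is $\chi_O$ with $\chi\vdash c:\chi_O$, $\vec x\subseteq\chi_O$, $\mathrm{fv}(c)\subseteq\chi\cup\vec x$, and $\chi_O\vdash\varphi$ (bound variables $\vec x$ chosen fresh). -}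

module Defs where

open import Level using (0ℓ)
open import Data.Nat using (ℕ)
open import Data.Fin using (Fin)
open import Data.List using (List)
open import Data.List.Relation.Unary.Any using (Any)
open import Data.List.Relation.Unary.All using (All)
open import Data.List.Membership.Propositional using (_∈_)
open import Data.Vec using (Vec; lookup)
open import Data.Product using (Σ; _×_)
open import Data.Sum using (_⊎_)
open import Relation.Binary.PropositionalEquality using (_≢_)
open import Relation.Unary using (Pred)

Var : Set
Var = ℕ

VarSet : Set₁
VarSet = Pred Var 0ℓ

_⊆V_ : VarSet → VarSet → Set
χ ⊆V χ' = ∀ x → χ x → χ' x

_∪V_ : VarSet → VarSet → VarSet
(χ ∪V χ') x = χ x ⊎ χ' x

_∩V_ : VarSet → VarSet → VarSet
(χ ∩V χ') x = χ x × χ' x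

_∖V_ : VarSet → Var → VarSet
(χ ∖V x) y = χ y × y ≢ x

⟦_⟧V : List Var → VarSet
⟦ xs ⟧V y = y ∈ xs

data Term : Set where
  var : Var → Term
  fn  : ℕ → List Term → Term

data _∈fvT_ : Var → Term → Set where
  here : ∀ {x} → x ∈fvT var x
  arg  : ∀ {x f ts} → Any (x ∈fvT_) ts → x ∈fvT fn f ts

fvT : Term → VarSet
fvT t x = x ∈fvT t

fvTs : List Term → VarSet
fvTs ts x = Any (x ∈fvT_) ts

record Sig : Set₁ where
  field
    ObjPred  : Set
    objArity : ObjPred → ℕ
    In       : (p : ObjPred) → Fin (objArity p) → Set
    Out      : (p : ObjPred) → Fin (objArity p) → Set
    SubjPred : Set

module Syntax (Σg : Sig) where
  open Sig Σg

  AnyPred : Set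
  AnyPred = ObjPred ⊎ SubjPred

  data Restr : Set where
    objAt  : (p : ObjPred) → Vec Term (objArity p) → Restr
    notIn  : List Var → List (List Term) → Restr     -- x⃗ ∉ S  (S: finite set of ground-term tuples)
    ⊤R ⊥R  : Restr
    _∧R_   : Restr → Restr → Restr
    _∨R_   : Restr → Restr → Restr
    ∃R     : Var → Restr → Restr

  data Form : Set where
    atom   : AnyPred → List Term → Form
    ⊤F ⊥F  : Form
    _∧F_   : Form → Form → Form
    _∨F_   : Form → Form → Form
    ∀F     : List Var → Restr → Form → Form     -- ∀x⃗.(c ⊃ φ)
    ∃F     : List Var → Restr → Form → Form     -- ∃x⃗.(c ∧ φ)

  data _∈fvR_ : Var → Restr → Set where
    objAt : ∀ {x p ts} j → x ∈fvT lookup ts j → x ∈fvR objAt p ts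
    notIn : ∀ {x xs S} → x ∈ xs → x ∈fvR notIn xs S
    ∧ˡ    : ∀ {x c₁ c₂} → x ∈fvR c₁ → x ∈fvR (c₁ ∧R c₂)
    ∧ʳ    : ∀ {x c₁ c₂} → x ∈fvR c₂ → x ∈fvR (c₁ ∧R c₂)
    ∨ˡ    : ∀ {x c₁ c₂} → x ∈fvR c₁ → x ∈fvR (c₁ ∨R c₂)
    ∨ʳ    : ∀ {x c₁ c₂} → x ∈fvR c₂ → x ∈fvR (c₁ ∨R c₂)
    ∃R    : ∀ {x y c} → x ≢ y → x ∈fvR c → x ∈fvR ∃R y c

  fvR : Restr → VarSet
  fvR c x = x ∈fvR c

  outVars : (p : ObjPred) → Vec Term (objArity p) → VarSet
  outVars p ts x = Σ (Fin (objArity p)) λ j → Out p j × x ∈fvT lookup ts j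

  data _⊢R_∶_ : VarSet → Restr → VarSet → Set₁ where
    objAt : ∀ {χI p ts} →
            (∀ k → In p k → fvT (lookup ts k) ⊆V χI) →
            χI ⊢R objAt p ts ∶ (χI ∪V outVars p ts)
    -- x⃗ ∉ S : all positions are input
    notIn : ∀ {χI xs S} → ⟦ xs ⟧V ⊆V χI → χI ⊢R notIn xs S ∶ χI
    ⊤R    : ∀ {χI} → χI ⊢R ⊤R ∶ χI
    ⊥R    : ∀ {χI} → χI ⊢R ⊥R ∶ χI
    ∧R    : ∀ {χI χ χO c₁ c₂} → χI ⊢R c₁ ∶ χ → χ ⊢R c₂ ∶ χO →
            χI ⊢R (c₁ ∧R c₂) ∶ χO
    ∨R    : ∀ {χI χ₁ χ₂ c₁ c₂} → χI ⊢R c₁ ∶ χ₁ → χI ⊢R c₂ ∶ χ₂ →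
            χI ⊢R (c₁ ∨R c₂) ∶ (χ₁ ∩V χ₂)
    ∃R    : ∀ {χI χO x c} → χI ⊢R c ∶ χO → χI ⊢R ∃R x c ∶ (χO ∖V x)

  data _⊢F_ : VarSet → Form → Set₁ where
    atom : ∀ {χ p ts} → All (λ t → fvT t ⊆V χ) ts → χ ⊢F atom p ts
    ⊤F   : ∀ {χ} → χ ⊢F ⊤F
    ⊥F   : ∀ {χ} → χ ⊢F ⊥F
    ∧F   : ∀ {χ φ₁ φ₂} → χ ⊢F φ₁ → χ ⊢F φ₂ → χ ⊢F (φ₁ ∧F φ₂)
    ∨F   : ∀ {χ φ₁ φ₂} → χ ⊢F φ₁ → χ ⊢F φ₂ → χ ⊢F (φ₁ ∨F φ₂)
    ∀F   : ∀ {χ xs c φ} (χO : VarSet) → χ ⊢R c ∶ χO → ⟦ xs ⟧V ⊆V χO →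
           fvR c ⊆V (χ ∪V ⟦ xs ⟧V) → χO ⊢F φ → χ ⊢F ∀F xs c φ
    ∃F   : ∀ {χ xs c φ} (χO : VarSet) → χ ⊢R c ∶ χO → ⟦ xs ⟧V ⊆V χO →
           fvR c ⊆V (χ ∪V ⟦ xs ⟧V) → χO ⊢F φ → χ ⊢F ∃F xs c φ

module Submission where

open import Defs
open import Data.Product using (Σ; _×_; _,_; ∃-syntax)
open import Data.Sum using (inj₁; inj₂)
import Data.List.Relation.Unary.All as All

-- For a restriction the new output set is
-- recomputed from the enlarged input set along the derivation; it contains the old
-- one because every rule builds its output from its input by ∪, ∩ and ∖, which are
-- monotone in that argument.

⊆V-trans : ∀ {χ₁ χ₂ χ₃} → χ₁ ⊆V χ₂ → χ₂ ⊆V χ₃ → χ₁ ⊆V χ₃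
⊆V-trans s t x m = t x (s x m)

∪V-monoˡ : ∀ {χ χ'} ψ → χ ⊆V χ' → (χ ∪V ψ) ⊆V (χ' ∪V ψ)
∪V-monoˡ ψ s x (inj₁ m) = inj₁ (s x m)
∪V-monoˡ ψ s x (inj₂ m) = inj₂ m

∩V-mono : ∀ {χ₁ χ₁' χ₂ χ₂'} → χ₁ ⊆V χ₁' → χ₂ ⊆V χ₂' → (χ₁ ∩V χ₂) ⊆V (χ₁' ∩V χ₂')
∩V-mono s t x (m₁ , m₂) = s x m₁ , t x m₂

∖V-monoˡ : ∀ {χ χ'} y → χ ⊆V χ' → (χ ∖V y) ⊆V (χ' ∖V y)
∖V-monoˡ y s x (m , x≢y) = s x m , x≢y

module Weakening (Σg : Sig) where
  open Syntax Σg

  ⊢R-weaken : ∀ {χI χO χI' c} → χI ⊢R c ∶ χO → χI ⊆V χI' →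
              ∃[ χO' ] (χO ⊆V χO') × (χI' ⊢R c ∶ χO')
  ⊢R-weaken (objAt {p = p} {ts} ins) s =
    _ , ∪V-monoˡ (outVars p ts) s , objAt (λ k k∈I → ⊆V-trans (ins k k∈I) s)
  ⊢R-weaken {χI' = χI'} (notIn xs⊆χI) s = χI' , s , notIn (⊆V-trans xs⊆χI s)
  ⊢R-weaken {χI' = χI'} ⊤R s = χI' , s , ⊤R
  ⊢R-weaken {χI' = χI'} ⊥R s = χI' , s , ⊥R
  ⊢R-weaken (∧R d₁ d₂) s with ⊢R-weaken d₁ s
  ... | _ , s₁ , d₁' with ⊢R-weaken d₂ s₁
  ...   | _ , s₂ , d₂' = _ , s₂ , ∧R d₁' d₂'
  ⊢R-weaken (∨R d₁ d₂) s with ⊢R-weaken d₁ s | ⊢R-weaken d₂ s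
  ... | _ , s₁ , d₁' | _ , s₂ , d₂' = _ , ∩V-mono s₁ s₂ , ∨R d₁' d₂'
  ⊢R-weaken (∃R {x = x} d) s with ⊢R-weaken d s
  ... | _ , s' , d' = _ , ∖V-monoˡ x s' , ∃R d'

  ⊢F-weaken : ∀ {χ χ' φ} → χ ⊢F φ → χ ⊆V χ' → χ' ⊢F φ
  ⊢F-weaken (atom fvs⊆χ) s = atom (All.map (λ fv⊆χ → ⊆V-trans fv⊆χ s) fvs⊆χ)
  ⊢F-weaken ⊤F s = ⊤F
  ⊢F-weaken ⊥F s = ⊥F
  ⊢F-weaken (∧F d₁ d₂) s = ∧F (⊢F-weaken d₁ s) (⊢F-weaken d₂ s)
  ⊢F-weaken (∨F d₁ d₂) s = ∨F (⊢F-weaken d₁ s) (⊢F-weaken d₂ s)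
  ⊢F-weaken (∀F {xs = xs} _ dc xs⊆χO fvc dφ) s with ⊢R-weaken dc s
  ... | χO' , sO , dc' =
    ∀F χO' dc' (⊆V-trans xs⊆χO sO) (⊆V-trans fvc (∪V-monoˡ ⟦ xs ⟧V s)) (⊢F-weaken dφ sO)
  ⊢F-weaken (∃F {xs = xs} _ dc xs⊆χO fvc dφ) s with ⊢R-weaken dc s
  ... | χO' , sO , dc' =
    ∃F χO' dc' (⊆V-trans xs⊆χO sO) (⊆V-trans fvc (∪V-monoˡ ⟦ xs ⟧V s)) (⊢F-weaken dφ sO)

mainTheorem9 : (Σg : Sig) → let open Syntax Σg in
    (∀ (χI χO χI' : VarSet) (c : Restr) → χI ⊢R c ∶ χO → χI ⊆V χI' →
       Σ VarSet λ χO' → (χO ⊆V χO') × (χI' ⊢R c ∶ χO'))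
    × (∀ (χ χ' : VarSet) (φ : Form) → χ ⊢F φ → χ ⊆V χ' → χ' ⊢F φ)
mainTheorem9 Σg = (λ _ _ _ _ → ⊢R-weaken) , (λ _ _ _ → ⊢F-weaken)
  where open Weakening Σg
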